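{- Let $\mathcal{N}\subset\mathbb{N}$ be a subset such that for each $m\in\mathbb{N}$ there is some $n\in\mathcal{N}$ divisible by $m$. Let $J,M$ be natural numbers and let $a_{j,i}\in\mathbb{Z}$ and $b_j\in\mathbb{Z}$, for $(j,i)\in\{1,\ldots,J\}\times\{1,\ldots,M\}$, be fixed integers. Suppose that for each $n\in\mathcal{N}$ there are integers $e_{i,n}$, $i\in\{1,\ldots,M\}$, such that $n$ divides $b_j-\sum_{i=1}^M a_{j,i}e_{i,n}$ for each $j\in\{1,\ldots,J\}$. Then there is some $n_0\in\mathcal{N}$ with the following property: for each $n\in\mathcal{N}$ divisible by $n_0$, there are integers $e'_{i,n}$, $i\in\{1,\ldots,M\}$, such that $n/n_0$ divides $e_{i,n}-e'_{i,n}$ for each $i$ and $b_j=\sum_{i=1}^M a_{j,i}e'_{i,n}$ for each $j\in\{1,\ldots,J\}$.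
   Context: $\mathbb{N}$ denotes the positive integers. -}

module Defs where

open import Data.Nat using (ℕ; zero; suc)
open import Data.Fin using (Fin; zero; suc)
open import Data.Integer using (ℤ; _+_; _*_; 0ℤ)

-- Σ_{i=1}^{M} f i, with indices {1..M} represented by Fin M
∑ : (M : ℕ) → (Fin M → ℤ) → ℤ
∑ zero f = 0ℤ
∑ (suc M) f = f zero + ∑ M (λ i → f (suc i))

linComb : {J M : ℕ} → (Fin J → Fin M → ℤ) → (Fin M → ℤ) → Fin J → ℤ
linComb {M = M} a e j = ∑ M (λ i → a j i * e i)

-- Gaussian elimination over ℤ that keeps track of congruences. Call K ≠ 0 a lifting modulus for
-- the system a e = b if every solution modulo q·K is congruent modulo q to an exact solution.
-- One exists, by induction on the number of unknowns. Without unknowns, 1 + ∣b j∣ works for any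
-- nonzero b j, since then there are no solutions modulo its multiples; a zero column is dropped;
-- otherwise a pivot d in the first column eliminates the first unknown from the other rows, and
-- K′·d works when K′ works for the reduced system: a solution ε″ of the reduced system close to
-- the given one lets the pivot row be solved for the first unknown. The theorem follows by
-- choosing n₀ ∈ 𝒩 divisible by a lifting modulus.
module Submission where

open import Defs
open import Data.Nat using (ℕ; _<_) renaming (_*_ to _*ℕ_)
open import Data.Fin using (Fin)
open import Data.Integer using (ℤ; _-_; +_)
open import Data.Integer.Divisibility using (_∣_)
open import Data.Product using (Σ; _×_; ∃)
open import Relation.Binary.PropositionalEquality using (_≡_)

open import Data.Fin using (zero; suc)
open import Data.Fin.Properties using (all?; ¬∀⟶∃¬)
open import Data.Integer using (_+_; _*_; -_; 0ℤ; 1ℤ; ∣_∣; NonZero; ≢-nonZero; _≟_)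
open import Data.Integer.Divisibility.Signed
  using (divides; quotient; ∣m⇒∣m*n; ∣ᵤ⇒∣; ∣⇒∣ᵤ; ∣-refl; ∣-trans; ∣m⇒∣-m; ∣m∣n⇒∣m+n; ∣m∣n⇒∣m-n; ∣n⇒∣m*n)
  renaming (_∣_ to _∣ˢ_; module _∣_ to ∣ˢ)
open import Data.Integer.Properties using (+-identityˡ; +-identityʳ; +-inverseʳ; *-cancelˡ-≡; i*j≢0; abs-*)
open import Data.Integer.Tactic.RingSolver using (solve-∀)
import Data.Nat as ℕ
import Data.Nat.Divisibility as ℕ
import Data.Nat.Properties as ℕ
open import Data.Product using (_,_; proj₁; proj₂; ∃-syntax)
open import Data.Sum using (_⊎_; inj₁; inj₂)
open import Data.Vec.Functional using (_∷_; tail; map)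
open import Function using (_∘_)
open import Relation.Nullary using (¬_; yes; no; contradiction)
open import Relation.Binary.PropositionalEquality
  using (_≢_; refl; sym; trans; cong; subst; subst₂; module ≡-Reasoning)

private
  variable
    J M : ℕ

residual : (Fin J → Fin M → ℤ) → (Fin J → ℤ) → (Fin M → ℤ) → Fin J → ℤ
residual a b e j = b j - linComb a e j

LiftingModulus : (Fin J → Fin M → ℤ) → (Fin J → ℤ) → ℤ → Set
LiftingModulus {J} {M} a b K = ∀ q (e : Fin M → ℤ) → (∀ j → q * K ∣ˢ residual a b e j)
  → ∃[ e′ ] (∀ i → q ∣ˢ e i - e′ i) × (∀ j → b j ≡ linComb a e′ j)

allZero⊎nonZeroEntry : (f : Fin J → ℤ) → (∀ j → f j ≡ 0ℤ) ⊎ ∃[ j ] f j ≢ 0ℤ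
allZero⊎nonZeroEntry {J} f with all? (λ j → f j ≟ 0ℤ)
... | yes f≡0 = inj₁ f≡0
... | no f≢0 = inj₂ (¬∀⟶∃¬ J _ (λ j → f j ≟ 0ℤ) f≢0)

linComb-cong-∣ : (a : Fin J → Fin M → ℤ) {k : ℤ} {e e′ : Fin M → ℤ} →
  (∀ i → k ∣ˢ e i - e′ i) → ∀ j → k ∣ˢ linComb a e j - linComb a e′ j
linComb-cong-∣ {M = ℕ.zero} a _ j = divides 0ℤ refl
linComb-cong-∣ {M = ℕ.suc M} a {k} {e} {e′} e≡e′ j =
  subst (k ∣ˢ_) (split (a j zero) (e zero) (e′ zero) _ _)
    (∣m∣n⇒∣m+n (∣n⇒∣m*n (a j zero) (e≡e′ zero)) (linComb-cong-∣ (map tail a) (λ i → e≡e′ (suc i)) j))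
  where
  split : ∀ x y y′ L L′ → x * (y - y′) + (L - L′) ≡ (x * y + L) - (x * y′ + L′)
  split = solve-∀

linComb-combineRows : (d : ℤ) (c : Fin J → ℤ) (j₀ : Fin J) (a : Fin J → Fin M → ℤ) (e : Fin M → ℤ)
  (j : Fin J) → linComb (λ j i → d * a j i - c j * a j₀ i) e j ≡ d * linComb a e j - c j * linComb a e j₀
linComb-combineRows {M = ℕ.zero} d c j₀ a e j = annihilate d (c j)
  where
  annihilate : ∀ x y → 0ℤ ≡ x * 0ℤ - y * 0ℤ
  annihilate = solve-∀
linComb-combineRows {M = ℕ.suc M} d c j₀ a e j =
  trans (cong (λ L → (d * a j zero - c j * a j₀ zero) * e zero + L)
              (linComb-combineRows d c j₀ (map tail a) (tail e) j))
        (distribute d (c j) (a j zero) (a j₀ zero) (e zero) _ _)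
  where
  distribute : ∀ x y u v z L L₀ →
    (x * u - y * v) * z + (x * L - y * L₀) ≡ x * (u * z + L) - y * (v * z + L₀)
  distribute = solve-∀

1+∣i∣∤i : {i : ℤ} → i ≢ 0ℤ → ¬ (+ ℕ.suc ∣ i ∣ ∣ˢ i)
1+∣i∣∤i {i} i≢0 = ℕ.>⇒∤ {{≢-nonZero i≢0}} (ℕ.n<1+n ∣ i ∣) ∘ ∣⇒∣ᵤ

∃liftingModulus-noUnknowns : (a : Fin J → Fin 0 → ℤ) (b : Fin J → ℤ) →
  ∃[ K ] NonZero K × LiftingModulus a b K
∃liftingModulus-noUnknowns a b with allZero⊎nonZeroEntry b
... | inj₁ b≡0 = 1ℤ , _ , λ q e _ → e , (λ ()) , b≡0
... | inj₂ (j , bⱼ≢0) = + ℕ.suc ∣ b j ∣ , _ , λ q e approx →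
  contradiction (subst (+ ℕ.suc ∣ b j ∣ ∣ˢ_) (+-identityʳ (b j)) (∣-trans (∣n⇒∣m*n q ∣-refl) (approx j)))
                (1+∣i∣∤i bⱼ≢0)

liftingModulus-dropZeroColumn : {a : Fin J → Fin (ℕ.suc M) → ℤ} {b : Fin J → ℤ} {K : ℤ} →
  (∀ j → a j zero ≡ 0ℤ) → LiftingModulus (map tail a) b K → LiftingModulus a b K
liftingModulus-dropZeroColumn {M = M} {a = a} {b} {K} column≡0 lift q e approx =
  e zero ∷ ε″ , congruent , λ j → trans (solves j) (sym (dropColumn (e zero) ε″ j))
  where
  dropColumn : ∀ x ε j → linComb a (x ∷ ε) j ≡ linComb (map tail a) ε j
  dropColumn x ε j = trans (cong (λ c → c * x + linComb (map tail a) ε j) (column≡0 j)) (+-identityˡ _)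
  lifted : ∃[ ε″ ] (∀ i → q ∣ˢ tail e i - ε″ i) × (∀ j → b j ≡ linComb (map tail a) ε″ j)
  lifted = lift q (tail e)
    (λ j → subst (q * K ∣ˢ_) (cong (λ L → b j - L) (dropColumn (e zero) (tail e) j)) (approx j))
  ε″ : Fin M → ℤ
  ε″ = proj₁ lifted
  solves : ∀ j → b j ≡ linComb (map tail a) ε″ j
  solves = proj₂ (proj₂ lifted)
  congruent : ∀ i → q ∣ˢ e i - (e zero ∷ ε″) i
  congruent zero = subst (q ∣ˢ_) (sym (+-inverseʳ (e zero))) (divides 0ℤ refl)
  congruent (suc i) = proj₁ (proj₂ lifted) i

module Pivot (a : Fin J → Fin (ℕ.suc M) → ℤ) (b : Fin J → ℤ) (j₀ : Fin J) where

  d : ℤ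
  d = a j₀ zero

  c : Fin J → ℤ
  c j = a j zero

  reducedMatrix : Fin J → Fin M → ℤ
  reducedMatrix j i = d * a j (suc i) - c j * a j₀ (suc i)

  reducedRhs : Fin J → ℤ
  reducedRhs j = d * b j - c j * b j₀

  residual-reduced : (e : Fin (ℕ.suc M) → ℤ) (j : Fin J) →
    residual reducedMatrix reducedRhs (tail e) j ≡ d * residual a b e j - c j * residual a b e j₀
  residual-reduced e j = begin
    reducedRhs j - linComb reducedMatrix (tail e) j
      ≡⟨ cong (λ L → reducedRhs j - L) (linComb-combineRows d c j₀ (map tail a) (tail e) j) ⟩
    reducedRhs j - (d * linComb (map tail a) (tail e) j - c j * linComb (map tail a) (tail e) j₀)
      ≡⟨ eliminate d (c j) (b j) (b j₀) (e zero) _ _ ⟩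
    d * residual a b e j - c j * residual a b e j₀ ∎
    where
    open ≡-Reasoning
    eliminate : ∀ d c bⱼ b₀ x Lⱼ L₀ →
      (d * bⱼ - c * b₀) - (d * Lⱼ - c * L₀) ≡ d * (bⱼ - (c * x + Lⱼ)) - c * (b₀ - (d * x + L₀))
    eliminate = solve-∀

  liftingModulus : {K : ℤ} .{{_ : NonZero d}} →
    LiftingModulus reducedMatrix reducedRhs K → LiftingModulus a b (K * d)
  liftingModulus {K} lift q e approx = y ∷ ε″ , congruent , solves
    where
    open ≡-Reasoning
    L L″ : Fin J → ℤ
    L = linComb (map tail a) (tail e)
    reassociate : ∀ q K d → q * (K * d) ≡ q * d * K
    reassociate = solve-∀
    approx″ : ∀ j → q * d * K ∣ˢ residual reducedMatrix reducedRhs (tail e) j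
    approx″ j = subst₂ _∣ˢ_ (reassociate q K d) (sym (residual-reduced e j))
      (∣m∣n⇒∣m-n (∣n⇒∣m*n d (approx j)) (∣n⇒∣m*n (c j) (approx j₀)))
    lifted : ∃[ ε″ ] (∀ i → q * d ∣ˢ tail e i - ε″ i) × (∀ j → reducedRhs j ≡ linComb reducedMatrix ε″ j)
    lifted = lift (q * d) (tail e) approx″
    ε″ : Fin M → ℤ
    ε″ = proj₁ lifted
    L″ = linComb (map tail a) ε″
    qd∣residual₀ : q * d ∣ˢ residual a b e j₀ + (L j₀ - L″ j₀)
    qd∣residual₀ = ∣m∣n⇒∣m+n
      (∣-trans (subst (q * d ∣ˢ_) (sym (reassociate q K d)) (∣m⇒∣m*n K ∣-refl)) (approx j₀))
      (linComb-cong-∣ (map tail a) (proj₁ (proj₂ lifted)) j₀)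
    -- y solves the pivot row against ε″ exactly and is still congruent to e zero modulo q.
    w y : ℤ
    w = quotient qd∣residual₀
    y = e zero + w * q
    pivotRow : b j₀ ≡ d * y + L″ j₀
    pivotRow = begin
      b j₀                                                 ≡⟨ expand (b j₀) d (e zero) (L j₀) (L″ j₀) ⟩
      (residual a b e j₀ + (L j₀ - L″ j₀)) + d * e zero + L″ j₀
        ≡⟨ cong (λ δ → δ + d * e zero + L″ j₀) (∣ˢ.equality qd∣residual₀) ⟩
      w * (q * d) + d * e zero + L″ j₀                      ≡⟨ collect w q d (e zero) (L″ j₀) ⟩
      d * y + L″ j₀                                        ∎
      where
      expand : ∀ b d x L L″ → b ≡ ((b - (d * x + L)) + (L - L″)) + d * x + L″
      expand = solve-∀
      collect : ∀ w q d x L″ → w * (q * d) + d * x + L″ ≡ d * (x + w * q) + L″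
      collect = solve-∀
    congruent : ∀ i → q ∣ˢ e i - (y ∷ ε″) i
    congruent zero = subst (q ∣ˢ_) (shift (e zero) (w * q)) (∣m⇒∣-m (∣n⇒∣m*n w ∣-refl))
      where
      shift : ∀ x u → - u ≡ x - (x + u)
      shift = solve-∀
    congruent (suc i) = ∣-trans (∣m⇒∣m*n d ∣-refl) (proj₁ (proj₂ lifted) i)
    solves : ∀ j → b j ≡ linComb a (y ∷ ε″) j
    solves j = *-cancelˡ-≡ d (b j) (c j * y + L″ j) (begin
      d * b j                                          ≡⟨ split (d * b j) (c j * b j₀) ⟩
      reducedRhs j + c j * b j₀
        ≡⟨ cong (λ r → r + c j * b j₀)
                (trans (proj₂ (proj₂ lifted) j) (linComb-combineRows d c j₀ (map tail a) ε″ j)) ⟩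
      (d * L″ j - c j * L″ j₀) + c j * b j₀
        ≡⟨ cong (λ b₀ → (d * L″ j - c j * L″ j₀) + c j * b₀) pivotRow ⟩
      (d * L″ j - c j * L″ j₀) + c j * (d * y + L″ j₀) ≡⟨ combine d (c j) y (L″ j) (L″ j₀) ⟩
      d * (c j * y + L″ j)                             ∎)
      where
      split : ∀ u v → u ≡ (u - v) + v
      split = solve-∀
      combine : ∀ d c y Lⱼ L₀ → (d * Lⱼ - c * L₀) + c * (d * y + L₀) ≡ d * (c * y + Lⱼ)
      combine = solve-∀

∃liftingModulus : (a : Fin J → Fin M → ℤ) (b : Fin J → ℤ) → ∃[ K ] NonZero K × LiftingModulus a b K
∃liftingModulus {M = ℕ.zero} a b = ∃liftingModulus-noUnknowns a b
∃liftingModulus {M = ℕ.suc M} a b with allZero⊎nonZeroEntry (λ j → a j zero)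
... | inj₁ column≡0 with ∃liftingModulus (map tail a) b
...   | K , K≢0 , lift = K , K≢0 , liftingModulus-dropZeroColumn {a = a} column≡0 lift
∃liftingModulus {M = ℕ.suc M} a b | inj₂ (j₀ , d≢0)
  with ∃liftingModulus (Pivot.reducedMatrix a b j₀) (Pivot.reducedRhs a b j₀)
...   | K , K≢0 , lift =
  K * d , i*j≢0 K d {{K≢0}} {{≢-nonZero d≢0}} , Pivot.liftingModulus a b j₀ {{≢-nonZero d≢0}} lift
  where d = a j₀ zero

liftingModulus-multiple : {a : Fin J → Fin M → ℤ} {b : Fin J → ℤ} {K : ℤ} (t : ℤ) →
  LiftingModulus a b K → LiftingModulus a b (t * K)
liftingModulus-multiple {a = a} {b} {K} t lift q e approx =
  let e′ , congruent , solves =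
        lift (q * t) e (λ j → subst (_∣ˢ residual a b e j) (reassociate q t K) (approx j))
  in e′ , (λ i → ∣-trans (∣m⇒∣m*n t ∣-refl) (congruent i)) , solves
  where
  reassociate : ∀ q t K → q * (t * K) ≡ q * t * K
  reassociate = solve-∀

lemma3p2 : (𝒩 : ℕ → Set) → (∀ n → 𝒩 n → 0 < n)
    → (∀ m → 0 < m → Σ ℕ (λ n → 𝒩 n × (+ m ∣ + n)))
    → (J M : ℕ) → (a : Fin J → Fin M → ℤ) → (b : Fin J → ℤ)
    → (e : (n : ℕ) → 𝒩 n → Fin M → ℤ)
    → (∀ n (p : 𝒩 n) (j : Fin J) → + n ∣ (b j - linComb a (e n p) j))
    → Σ ℕ (λ n₀ → 𝒩 n₀ ×
        ((n : ℕ) → (p : 𝒩 n) → (q : ℕ) → n ≡ q *ℕ n₀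
          → Σ (Fin M → ℤ) (λ e′ →
              ((i : Fin M) → + q ∣ (e n p i - e′ i))
              × ((j : Fin J) → b j ≡ linComb a e′ j))))
lemma3p2 𝒩 _ cofinal J M a b e approx with ∃liftingModulus a b
... | K , K≢0 , lift with cofinal ∣ K ∣ (ℕ.>-nonZero⁻¹ ∣ K ∣ {{K≢0}})
... | n₀ , n₀∈𝒩 , ℕ.divides t n₀≡t∣K∣ = n₀ , n₀∈𝒩 , λ n n∈𝒩 q n≡qn₀ →
  let e′ , congruent , solves = liftingModulus-multiple {a = a} {b} (+ t) lift (+ q) (e n n∈𝒩)
        (λ j → ∣ᵤ⇒∣ (subst (ℕ._∣ _) (sym (modulus q n≡qn₀)) (approx n n∈𝒩 j)))
  in e′ , (λ i → ∣⇒∣ᵤ (congruent i)) , solves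
  where
  modulus : ∀ {n} q → n ≡ q *ℕ n₀ → ∣ + q * (+ t * K) ∣ ≡ n
  modulus {n} q n≡qn₀ = begin
    ∣ + q * (+ t * K) ∣  ≡⟨ abs-* (+ q) (+ t * K) ⟩
    q *ℕ ∣ + t * K ∣    ≡⟨ cong (q *ℕ_) (trans (abs-* (+ t) K) (sym n₀≡t∣K∣)) ⟩
    q *ℕ n₀             ≡⟨ sym n≡qn₀ ⟩
    n                   ∎
    where open ≡-Reasoning
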